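{- Let $X\subseteq\mathbb{N}$ with $|X|=\ell\ge2$. If the compatibility graph $\mathcal{C}_X$ contains a half-induced matching of size $\ell+1$, then $X$ is an arithmetic progression.
   Context: An arithmetic progression is a set $\{a,a+d,\dots,a+(m-1)d\}$ with $d\ge1$. For $X\subseteq\mathbb{N}$, $\mathcal{C}_X$ is the bipartite graph whose two sides $U,V$ are both copies of $\mathbb{N}$, with $i\in U$ adjacent to $j\in V$ iff $i+j\notin X$. A bipartite graph with sides $U,V$ and edge set $E$ has a half-induced matching of size $h$ if there are pairwise distinct $a_1,\dots,a_h\in U$ and pairwise distinct $b_1,\dots,b_h\in V$ such that $(a_i,b_i)\in E$ for all $i$ and $(a_i,b_j)\notin E$ for all $j>i$. -}

module Defs where

open import Data.Nat using (ℕ; _+_; _*_; _<_; _≥_)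
open import Data.Fin using (Fin)
import Data.Fin as F
open import Data.List using (List)
open import Data.List.Membership.Propositional using (_∈_; _∉_)
open import Data.Product using (Σ; _×_; ∃-syntax)
open import Function.Definitions using (Injective)
open import Function.Bundles using (_⇔_)
open import Relation.Binary.PropositionalEquality using (_≡_)
open import Relation.Nullary using (¬_)

-- A finite subset X of ℕ is represented by a duplicate-free list (see Statement).
-- Arithmetic progression {a, a+d, ..., a+(m-1)d} with d ≥ 1.
IsAP : List ℕ → Set
IsAP X = Σ ℕ λ a → Σ ℕ λ d → Σ ℕ λ m →
  (d ≥ 1) × ((x : ℕ) → (x ∈ X) ⇔ (∃[ i ] (i < m × x ≡ a + i * d)))

CEdge : List ℕ → ℕ → ℕ → Set
CEdge X i j = (i + j) ∉ X

HalfInducedMatching : List ℕ → ℕ → Set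
HalfInducedMatching X h =
  Σ (Fin h → ℕ) λ a → Σ (Fin h → ℕ) λ b →
    Injective _≡_ _≡_ a × Injective _≡_ _≡_ b ×
    ((i : Fin h) → CEdge X (a i) (b i)) ×
    ((i j : Fin h) → i F.< j → ¬ CEdge X (a i) (b j))

{-# OPTIONS --safe #-}
-- Write aᵢ, bⱼ for the matching and x₀ = a₀ + b₁.  The ℓ distinct sums a₀ + bⱼ (j ≥ 1) are all
-- non-edges, so they exhaust X; the sums a₁ + bⱼ (j ≥ 2) lie in X as well.  Hence every element
-- of X other than x₀ moves by a₁ − a₀ to another element of X.  If a₀ > a₁, following these
-- downward steps from any element ends at x₀, so X is an initial segment of the progression
-- x₀, x₀ + D, … with D = a₀ − a₁; if a₀ < a₁, the upward steps end at x₀ and X is a segment ending at x₀.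
module Submission where

open import Defs
open import Data.Nat using (ℕ; suc; zero; _≥_; _+_; _*_; _≤_; _<_; _∸_; z≤n; s≤s; _≟_)
open import Data.Nat.Properties
open import Data.Nat.Induction using (<-rec)
open import Data.Nat.Solver using (module +-*-Solver)
open import Data.List using (List; length; _∷_; []; lookup)
open import Data.List.Extrema.Nat using (max; min; argmax-sel; argmin-sel; ⊥≤max; xs≤max; min≤⊤; min≤xs)
open import Data.List.Relation.Unary.All as All using (_∷_)
open import Data.List.Relation.Unary.Unique.Propositional using (Unique)
open import Data.List.Relation.Unary.Any using (here; there; index)
open import Data.List.Relation.Unary.Any.Properties using (lookup-index)
open import Data.List.Membership.Propositional using (_∈_)
open import Data.List.Membership.DecPropositional _≟_ using (_∈?_)
open import Data.Fin as F using (Fin; punchOut)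
open import Data.Fin.Properties using (any?; injective⇒≤; punchOut-injective) renaming (suc-injective to Fin-suc-injective)
open import Data.Product using (∃; _×_; _,_)
open import Data.Sum using ([_,_]′)
open import Relation.Nullary using (yes; no; contradiction)
open import Relation.Nullary.Decidable using (decidable-stable)
open import Relation.Binary.PropositionalEquality
open import Relation.Binary.Definitions using (tri<; tri≈; tri>)
open import Function.Bundles using (mk⇔)
open import Function.Definitions using (Injective)

injective⇒surjective : ∀ {n} (f : Fin n → Fin n) → Injective _≡_ _≡_ f → ∀ t → ∃ λ j → f j ≡ t
injective⇒surjective {zero} f f-inj ()
injective⇒surjective {suc n} f f-inj t with any? (λ j → f j F.≟ t)
... | yes hit = hit
... | no miss = contradiction (injective⇒≤ {f = f′} f′-inj) 1+n≰n
  where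
  t≢f : ∀ j → t ≢ f j
  t≢f j eq = miss (j , sym eq)
  f′ : Fin (suc n) → Fin n
  f′ j = punchOut (t≢f j)
  f′-inj : Injective _≡_ _≡_ f′
  f′-inj {i} {j} eq = f-inj (punchOut-injective (t≢f i) (t≢f j) eq)

-- Compose e with the positions of its values in X to get an injection of Fin (length X) into itself.
injective∈⇒surjective : ∀ {a} {A : Set a} {X : List A} (e : Fin (length X) → A) →
  Injective _≡_ _≡_ e → (∀ j → e j ∈ X) → ∀ {z} → z ∈ X → ∃ λ j → e j ≡ z
injective∈⇒surjective {X = X} e e-inj e∈ z∈ =
  let j , pos-j≡pos-z = injective⇒surjective pos pos-inj (index z∈)
  in j , trans (lookup-index (e∈ j)) (trans (cong (lookup X) pos-j≡pos-z) (sym (lookup-index z∈)))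
  where
  pos : Fin (length X) → Fin (length X)
  pos j = index (e∈ j)
  pos-inj : Injective _≡_ _≡_ pos
  pos-inj {i} {j} eq = e-inj (trans (lookup-index (e∈ i)) (trans (cong (lookup X) eq) (sym (lookup-index (e∈ j)))))

max∈ : ∀ x xs → max x xs ∈ x ∷ xs
max∈ x xs = [ here , there ]′ (argmax-sel (λ z → z) x xs)

∈⇒≤max : ∀ {x xs z} → z ∈ x ∷ xs → z ≤ max x xs
∈⇒≤max {x} {xs} = All.lookup (⊥≤max x xs ∷ xs≤max x xs)

min∈ : ∀ x xs → min x xs ∈ x ∷ xs
min∈ x xs = [ here , there ]′ (argmin-sel (λ z → z) x xs)

∈⇒min≤ : ∀ {x xs z} → z ∈ x ∷ xs → min x xs ≤ z
∈⇒min≤ {x} {xs} = All.lookup (min≤⊤ x xs ∷ min≤xs x xs)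

*-cancelʳ-≤-offset : ∀ b {D} k K → D ≥ 1 → b + k * D ≤ b + K * D → k ≤ K
*-cancelʳ-≤-offset b {suc D} k K _ le = *-cancelʳ-≤ k K (suc D) (+-cancelˡ-≤ b _ _ le)

DownClosedIn : ℕ → ℕ → List ℕ → Set
DownClosedIn b D X = ∀ {z} → z ∈ X → ∃ λ k → z ≡ b + k * D × (∀ i → i ≤ k → b + i * D ∈ X)

downClosed⇒IsAP : ∀ {b D x xs} → D ≥ 1 → DownClosedIn b D (x ∷ xs) → IsAP (x ∷ xs)
downClosed⇒IsAP {b} {D} {x} {xs} D≥1 closed with closed (max∈ x xs)
... | K , max≡ , segment = b , D , suc K , D≥1 , λ z → mk⇔ (to z) (from z)
  where
  to : ∀ z → z ∈ x ∷ xs → ∃ λ i → i < suc K × z ≡ b + i * D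
  to z z∈ with closed z∈
  ... | k , z≡ , _ = k , s≤s (*-cancelʳ-≤-offset b k K D≥1 (subst₂ _≤_ z≡ max≡ (∈⇒≤max z∈))) , z≡
  from : ∀ z → (∃ λ i → i < suc K × z ≡ b + i * D) → z ∈ x ∷ xs
  from z (i , s≤s i≤K , refl) = segment i i≤K

+-suc-* : ∀ b k D → (b + k * D) + D ≡ b + suc k * D
+-suc-* = solve 3 (λ b k D → (b :+ k :* D) :+ D := b :+ (con 1 :+ k) :* D) refl
  where open +-*-Solver

extend-segment : ∀ {X : List ℕ} {b D k} → b + suc k * D ∈ X → (∀ i → i ≤ k → b + i * D ∈ X) →
  ∀ i → i ≤ suc k → b + i * D ∈ X
extend-segment {k = k} top below i i≤1+k with i ≟ suc k
... | yes refl = top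
... | no i≢1+k = below i (≤-pred (≤∧≢⇒< i≤1+k i≢1+k))

descending⇒downClosed : ∀ {X x₀ D} → D ≥ 1 → x₀ ∈ X →
  (∀ {z} → z ∈ X → z ≢ x₀ → ∃ λ z′ → z′ ∈ X × z ≡ z′ + D) → DownClosedIn x₀ D X
descending⇒downClosed {X} {x₀} {D} D≥1 x₀∈ step {z} = <-rec P descend z
  where
  P : ℕ → Set
  P z = z ∈ X → ∃ λ k → z ≡ x₀ + k * D × (∀ i → i ≤ k → x₀ + i * D ∈ X)
  base : ∀ i → i ≤ 0 → x₀ + i * D ∈ X
  base zero _ = subst (_∈ X) (sym (+-identityʳ x₀)) x₀∈
  descend : ∀ z → (∀ {z′} → z′ < z → P z′) → P z
  descend z rec z∈ with z ≟ x₀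
  ... | yes refl = 0 , sym (+-identityʳ z) , base
  ... | no z≢x₀ with step z∈ z≢x₀
  ...   | z′ , z′∈ , refl with rec (m<m+n z′ D≥1) z′∈
  ...     | k , refl , below = suc k , +-suc-* x₀ k D , extend-segment (subst (_∈ X) (+-suc-* x₀ k D) z∈) below

ascending-reaches : ∀ {x xs x₀ D} → D ≥ 1 → (∀ {z} → z ∈ x ∷ xs → z ≢ x₀ → z + D ∈ x ∷ xs) →
  ∀ {z} → z ∈ x ∷ xs → ∃ λ k → z + k * D ≡ x₀ × (∀ i → i ≤ k → z + i * D ∈ x ∷ xs)
ascending-reaches {x} {xs} {x₀} {D} D≥1 step {z} = climb (suc (max x xs)) z (m≤n+m _ z)
  where
  X = x ∷ xs
  climbed : ∀ z fuel → z + suc fuel ≤ (z + D) + fuel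
  climbed z fuel = ≤-trans (≤-reflexive (sym (+-assoc z 1 fuel))) (+-monoˡ-≤ fuel (+-monoʳ-≤ z D≥1))
  climb : ∀ fuel z → max x xs < z + fuel → z ∈ X → ∃ λ k → z + k * D ≡ x₀ × (∀ i → i ≤ k → z + i * D ∈ X)
  climb zero z bound z∈ = contradiction (∈⇒≤max z∈) (<⇒≱ (subst (max x xs <_) (+-identityʳ z) bound))
  climb (suc fuel) z bound z∈ with z ≟ x₀
  ... | yes refl = 0 , +-identityʳ z , λ { zero _ → subst (_∈ X) (sym (+-identityʳ z)) z∈ }
  ... | no z≢x₀ with climb fuel (z + D) (<-≤-trans bound (climbed z fuel)) (step z∈ z≢x₀)
  ...   | k , reach , above = suc k , trans (sym (+-assoc z D (k * D))) reach , segment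
    where
    segment : ∀ i → i ≤ suc k → z + i * D ∈ X
    segment zero _ = subst (_∈ X) (sym (+-identityʳ z)) z∈
    segment (suc i) (s≤s i≤k) = subst (_∈ X) (+-assoc z D (i * D)) (above i i≤k)

offset-by-difference : ∀ z m D {k K} → k ≤ K → z + k * D ≡ m + K * D → z ≡ m + (K ∸ k) * D
offset-by-difference z m D {k} {K} k≤K eq = +-cancelʳ-≡ (k * D) z (m + (K ∸ k) * D) (begin
  z + k * D                 ≡⟨ eq ⟩
  m + K * D                 ≡⟨ cong (λ t → m + t * D) (sym (m∸n+n≡m k≤K)) ⟩
  m + (K ∸ k + k) * D       ≡⟨ cong (m +_) (*-distribʳ-+ D (K ∸ k) k) ⟩
  m + ((K ∸ k) * D + k * D) ≡⟨ sym (+-assoc m ((K ∸ k) * D) (k * D)) ⟩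
  m + (K ∸ k) * D + k * D   ∎)
  where open ≡-Reasoning

ascending⇒downClosed : ∀ {x xs x₀ D} → D ≥ 1 → (∀ {z} → z ∈ x ∷ xs → z ≢ x₀ → z + D ∈ x ∷ xs) →
  DownClosedIn (min x xs) D (x ∷ xs)
ascending⇒downClosed {x} {xs} {D = D} D≥1 step {z} z∈
  with K , m+KD≡x₀ , segment ← ascending-reaches D≥1 step (min∈ x xs)
     | k , z+kD≡x₀ , _ ← ascending-reaches D≥1 step z∈
  = K ∸ k , offset-by-difference z m D k≤K (trans z+kD≡x₀ (sym m+KD≡x₀))
  , λ i i≤K∸k → segment i (≤-trans i≤K∸k (m∸n≤m K k))
  where
  m = min x xs
  k≤K : k ≤ K
  k≤K = *-cancelʳ-≤-offset m k K D≥1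
    (≤-trans (+-monoˡ-≤ (k * D) (∈⇒min≤ z∈)) (≤-reflexive (trans z+kD≡x₀ (sym m+KD≡x₀))))

-- z ↦ z + p − q maps every element of X other than x₀ into X; stated without subtraction.
ShiftsExcept : ℕ → ℕ → ℕ → List ℕ → Set
ShiftsExcept x₀ p q X = ∀ {z} → z ∈ X → z ≢ x₀ → ∃ λ z′ → z′ ∈ X × z + p ≡ z′ + q

cancel-gap : ∀ z z′ p o → z + p ≡ z′ + (suc p + o) → z ≡ z′ + suc o
cancel-gap z z′ p o eq = +-cancelʳ-≡ p z (z′ + suc o) (trans eq (rearrange z′ p o))
  where
  open +-*-Solver
  rearrange : ∀ z′ p o → z′ + (suc p + o) ≡ z′ + suc o + p
  rearrange = solve 3 (λ z′ p o → z′ :+ ((con 1 :+ p) :+ o) := (z′ :+ (con 1 :+ o)) :+ p) refl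

shiftsExcept⇒IsAP : ∀ {x xs x₀ p q} → p ≢ q → x₀ ∈ x ∷ xs → ShiftsExcept x₀ p q (x ∷ xs) → IsAP (x ∷ xs)
shiftsExcept⇒IsAP {x} {xs} {p = p} {q = q} p≢q x₀∈ shifts with <-cmp p q
... | tri≈ _ p≡q _ = contradiction p≡q p≢q
... | tri< p<q _ _ =
  let o , p+1+o≡q = m≤n⇒∃[o]m+o≡n p<q
      down {z} z∈ z≢x₀ = let z′ , z′∈ , eq = shifts z∈ z≢x₀
                         in z′ , z′∈ , cancel-gap z z′ p o (trans eq (cong (z′ +_) (sym p+1+o≡q)))
  in downClosed⇒IsAP (s≤s z≤n) (descending⇒downClosed (s≤s z≤n) x₀∈ down)
... | tri> _ _ q<p =
  let o , q+1+o≡p = m≤n⇒∃[o]m+o≡n q<p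
      up {z} z∈ z≢x₀ = let z′ , z′∈ , eq = shifts z∈ z≢x₀
                       in subst (_∈ x ∷ xs) (cancel-gap z′ z q o (trans (sym eq) (cong (z +_) (sym q+1+o≡p)))) z′∈
  in downClosed⇒IsAP (s≤s z≤n) (ascending⇒downClosed (s≤s z≤n) up)

halfInducedMatching⇒shifts : ∀ {x xs} → HalfInducedMatching (x ∷ xs) (suc (length (x ∷ xs))) →
  ∃ λ x₀ → ∃ λ p → ∃ λ q → p ≢ q × x₀ ∈ x ∷ xs × ShiftsExcept x₀ p q (x ∷ xs)
halfInducedMatching⇒shifts {x} {xs} (a , b , a-inj , b-inj , _ , nonedge) =
  row₀ F.zero , a₁ , a₀ , a₁≢a₀ , row₀∈ F.zero , shifts
  where
  X = x ∷ xs
  a₀ a₁ : ℕ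
  a₀ = a F.zero
  a₁ = a (F.suc F.zero)
  a₁≢a₀ : a₁ ≢ a₀
  a₁≢a₀ eq with a-inj eq
  ... | ()
  row₀ : Fin (length X) → ℕ
  row₀ j = a₀ + b (F.suc j)
  row₀∈ : ∀ j → row₀ j ∈ X
  row₀∈ j = decidable-stable (_ ∈? X) (nonedge F.zero (F.suc j) (s≤s z≤n))
  row₁∈ : ∀ j → a₁ + b (F.suc (F.suc j)) ∈ X
  row₁∈ j = decidable-stable (_ ∈? X) (nonedge (F.suc F.zero) (F.suc (F.suc j)) (s≤s (s≤s z≤n)))
  row₀-inj : Injective _≡_ _≡_ row₀
  row₀-inj eq = Fin-suc-injective (b-inj (+-cancelˡ-≡ a₀ _ _ eq))
  exchange : ∀ a₀ a₁ c → a₀ + c + a₁ ≡ a₁ + c + a₀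
  exchange = solve 3 (λ a₀ a₁ c → a₀ :+ c :+ a₁ := a₁ :+ c :+ a₀) refl
    where open +-*-Solver
  shifts : ShiftsExcept (row₀ F.zero) a₁ a₀ X
  shifts z∈ z≢x₀ with injective∈⇒surjective row₀ row₀-inj row₀∈ z∈
  ... | F.zero , refl = contradiction refl z≢x₀
  ... | F.suc j , refl = a₁ + b (F.suc (F.suc j)) , row₁∈ j , exchange a₀ a₁ (b (F.suc (F.suc j)))

lemma4p3 : (X : List ℕ) → Unique X → length X ≥ 2 →
    HalfInducedMatching X (suc (length X)) → IsAP X
lemma4p3 [] _ () _
lemma4p3 (x ∷ xs) _ _ matching =
  let x₀ , p , q , p≢q , x₀∈ , shifts = halfInducedMatching⇒shifts matching
  in shiftsExcept⇒IsAP p≢q x₀∈ shifts
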